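{- For each $k\ge1$, the win-loss sequences for unicard games that end within $k$ passthroughs are in bijection with the full binary trees of height $k$, where height is measured as the number of levels and at most $k$ levels are allowed.
   Context: A win-loss sequence for a unicard game is a finite string $x_1\cdots x_R$ over $\{W,L\}$ such that, writing $w_i,\ell_i$ for the numbers of $W$'s and $L$'s among $x_1,\dots,x_i$, one has $1+w_i-\ell_i>0$ for $1\le i<R$ and $1+w_R-\ell_R=0$ (it records Alice's wins/losses in a game of War that she loses, starting from one card). Passthroughs: the first passthrough is the first letter, and each subsequent passthrough consists of the next $2t$ letters, where $t$ is the number of $W$'s in the previous passthrough; the sequence ends within $k$ passthroughs if it consists of at most $k$ passthroughs. A full binary tree is a rooted tree in which every non-leaf vertex has exactly two children; its number of levels is one more than the maximal distance from the root to a vertex. -}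

module Defs where

open import Data.Nat using (ℕ; zero; suc; _+_; _*_; _∸_; _<_; _≤_; _⊔_)
open import Data.List using (List; []; _∷_; length; take; drop; applyUpTo)
open import Data.List.Relation.Unary.All using (All)
open import Data.Product using (Σ; _×_)
open import Relation.Binary.PropositionalEquality using (_≡_)

data WL : Set where
  W L : WL

#W : List WL → ℕ
#W []      = 0
#W (W ∷ xs) = suc (#W xs)
#W (L ∷ xs) = #W xs

#L : List WL → ℕ
#L []      = 0
#L (W ∷ xs) = #L xs
#L (L ∷ xs) = suc (#L xs)

-- x₁⋯x_R is a win-loss sequence for a unicard game:
--   for 1 ≤ i < R : 1 + w_i - ℓ_i > 0   (i.e. ℓ_i < 1 + w_i)
--   at R         : 1 + w_R - ℓ_R = 0   (i.e. ℓ_R = 1 + w_R)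
-- where w_i, ℓ_i count W's, L's in the prefix of length i (take i xs).
IsWinLoss : List WL → Set
IsWinLoss xs =
  All (λ i → #L (take i xs) < suc (#W (take i xs)))
      (applyUpTo suc (length xs ∸ 1))
  × (#L xs ≡ suc (#W xs))

-- Passthrough decomposition.  'Within k n xs': the remaining letters xs,
-- whose next passthrough has length n, consist of at most k passthroughs.
Within : ℕ → ℕ → List WL → Set
Within zero    n xs = xs ≡ []
Within (suc k) n xs = Within k (2 * #W (take n xs)) (drop n xs)

EndsWithin : ℕ → List WL → Set
EndsWithin k xs = Within k 1 xs

data FBT : Set where
  leaf : FBT
  node : FBT → FBT → FBT

levels : FBT → ℕ
levels leaf       = 1
levels (node l r) = suc (levels l ⊔ levels r)

WinLossWithin : ℕ → Set
WinLossWithin k = Σ (List WL) (λ xs → IsWinLoss xs × EndsWithin k xs)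

TreesWithin : ℕ → Set
TreesWithin k = Σ FBT (λ t → levels t ≤ k)

{-# OPTIONS --safe #-}
-- Read a full binary tree in level order, writing W for an internal vertex
-- and L for a leaf. A level with t internal vertices is followed by a level
-- of 2t vertices, so the levels are exactly the passthroughs, and a tree
-- with at most k levels yields a word ending within k passthroughs. If Alice's
-- cards are the vertices still to be read, a W replaces one vertex by its two
-- children and an L removes one, so the word is a win-loss sequence started
-- from one card (the root). Conversely, the passthroughs of a win-loss
-- sequence rebuild the tree level by level from the bottom; the final count
-- ℓ = 1 + w is what forces every passthrough to have its full length.
module Submission where

open import Defs
open import Data.Nat using (ℕ; zero; suc; _+_; _*_; _∸_; _≤_; _<_; z≤n; s≤s)
open import Data.Nat.Properties
open import Data.Nat.Tactic.RingSolver using (solve-∀)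
open import Data.Empty using (⊥-elim)
open import Data.List using (List; []; _∷_; [_]; length; take; drop; _++_)
open import Data.List.Properties using (length-++; length-take; take++drop≡id; ≡-dec)
open import Data.List.Relation.Unary.All as All using (All; []; _∷_)
open import Data.List.Relation.Unary.All.Properties using (applyUpTo⁺₁)
open import Data.Product using (Σ; _×_; _,_; proj₁; proj₂)
open import Function.Bundles using (_⤖_; mk↔ₛ′)
open import Function.Properties.Inverse using (↔⇒⤖)
open import Relation.Binary.Definitions using (DecidableEquality)
open import Relation.Binary.PropositionalEquality
  using (_≡_; _≢_; refl; sym; trans; cong; cong₂; subst; module ≡-Reasoning)
open import Relation.Nullary using (¬_; yes; no; Irrelevant)
open import Axiom.UniquenessOfIdentityProofs using (module Decidable⇒UIP)

#W-++ : ∀ xs ys → #W (xs ++ ys) ≡ #W xs + #W ys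
#W-++ []       ys = refl
#W-++ (W ∷ xs) ys = cong suc (#W-++ xs ys)
#W-++ (L ∷ xs) ys = #W-++ xs ys

length≡#W+#L : ∀ xs → length xs ≡ #W xs + #L xs
length≡#W+#L []       = refl
length≡#W+#L (W ∷ xs) = cong suc (length≡#W+#L xs)
length≡#W+#L (L ∷ xs) = trans (cong suc (length≡#W+#L xs)) (sym (+-suc _ _))

take-length-++ : ∀ {A : Set} (xs ys : List A) → take (length xs) (xs ++ ys) ≡ xs
take-length-++ []       ys = refl
take-length-++ (x ∷ xs) ys = cong (x ∷_) (take-length-++ xs ys)

drop-length-++ : ∀ {A : Set} (xs ys : List A) → drop (length xs) (xs ++ ys) ≡ ys
drop-length-++ []       ys = refl
drop-length-++ (x ∷ xs) ys = drop-length-++ xs ys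

length-take≤ : ∀ {A : Set} n (xs : List A) → length (take n xs) ≤ n
length-take≤ n xs = ≤-trans (≤-reflexive (length-take n xs)) (m⊓n≤m n (length xs))

2+-injective : ∀ w {m} → suc (suc m) ≡ 2 * suc w → m ≡ 2 * w
2+-injective w e = suc-injective (suc-injective (trans e (*-suc 2 w)))

0≢2*suc : ∀ w → 0 ≢ 2 * suc w
0≢2*suc w ()

1≢2*suc : ∀ w → 1 ≢ 2 * suc w
1≢2*suc w e with suc-injective (trans e (*-suc 2 w))
... | ()

≤∧≤∧+≡+⇒≡ : ∀ {a b m n} → a ≤ m → b ≤ n → a + b ≡ m + n → a ≡ m × b ≡ n
≤∧≤∧+≡+⇒≡ {a} {b} {m} {n} a≤m b≤n a+b≡m+n =
  a≡m , +-cancelˡ-≡ m b n (trans (cong (_+ b) (sym a≡m)) a+b≡m+n)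
  where
  m≤a : m ≤ a
  m≤a = +-cancelʳ-≤ n m a (≤-trans (≤-reflexive (sym a+b≡m+n)) (+-monoʳ-≤ a b≤n))
  a≡m = ≤-antisym a≤m m≤a

-- LosingRecord n xs: xs records a game that Alice, starting with n cards,
-- loses exactly at its last letter; IsWinLoss is the case n = 1.
data LosingRecord : ℕ → List WL → Set where
  []   : LosingRecord 0 []
  win  : ∀ {n xs} → LosingRecord (suc (suc n)) xs → LosingRecord (suc n) (W ∷ xs)
  loss : ∀ {n xs} → LosingRecord n xs → LosingRecord (suc n) (L ∷ xs)

LosingRecord-count : ∀ {n xs} → LosingRecord n xs → #L xs ≡ n + #W xs
LosingRecord-count []       = refl
LosingRecord-count (win {n} {xs} r) = trans (LosingRecord-count r) (sym (+-suc (suc n) (#W xs)))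
LosingRecord-count (loss r) = cong suc (LosingRecord-count r)

LosingRecord-prefix : ∀ {n xs} → LosingRecord n xs →
                      ∀ {i} → i < length xs → #L (take i xs) < n + #W (take i xs)
LosingRecord-prefix (win r)  {zero}  _         = s≤s z≤n
LosingRecord-prefix (win {n} {xs} r) {suc i} (s≤s i<) =
  subst (#L (take i xs) <_) (sym (+-suc (suc n) (#W (take i xs)))) (LosingRecord-prefix r i<)
LosingRecord-prefix (loss r) {zero}  _         = s≤s z≤n
LosingRecord-prefix (loss r) {suc i} (s≤s i<) = s≤s (LosingRecord-prefix r i<)

LosingRecord-++ : ∀ ws {m ys} → LosingRecord (2 * #W ws + m) ys →
                  LosingRecord (length ws + m) (ws ++ ys)
LosingRecord-++ []       r = r
LosingRecord-++ (L ∷ ws) r = loss (LosingRecord-++ ws r)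
LosingRecord-++ (W ∷ ws) {m} {ys} r =
  win (subst (λ c → LosingRecord c (ws ++ ys)) (length-shift (length ws) m)
        (LosingRecord-++ ws (subst (λ c → LosingRecord c ys) (double-shift (#W ws) m) r)))
  where
  double-shift : ∀ w m → 2 * suc w + m ≡ 2 * w + suc (suc m)
  double-shift = solve-∀
  length-shift : ∀ l m → l + suc (suc m) ≡ suc (suc (l + m))
  length-shift = solve-∀

LosingRecord⇒IsWinLoss : ∀ {xs} → LosingRecord 1 xs → IsWinLoss xs
LosingRecord⇒IsWinLoss {xs} r =
  applyUpTo⁺₁ suc (length xs ∸ 1) (λ i<l-1 → LosingRecord-prefix r (<-pred⇒suc< i<l-1))
  , LosingRecord-count r
  where
  <-pred⇒suc< : ∀ {i l} → i < l ∸ 1 → suc i < l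
  <-pred⇒suc< {l = suc l} i<l = s≤s i<l

-- Within lets the last passthrough run short, since take truncates;
-- FullLength is the condition that rules this out.
FullLength : ℕ → List WL → Set
FullLength n xs = length xs ≡ n + 2 * #W xs

IsWinLoss⇒FullLength : ∀ {xs} → IsWinLoss xs → FullLength 1 xs
IsWinLoss⇒FullLength {xs} (_ , ℓ≡1+w) =
  trans (length≡#W+#L xs) (trans (cong (#W xs +_) ℓ≡1+w) (w+[1+w]≡1+2w (#W xs)))
  where
  w+[1+w]≡1+2w : ∀ w → w + suc w ≡ 1 + 2 * w
  w+[1+w]≡1+2w = solve-∀

within-++ : ∀ {k} ws {ys} → Within k (2 * #W ws) ys → Within (suc k) (length ws) (ws ++ ys)
within-++ ws {ys} w rewrite take-length-++ ws ys | drop-length-++ ws ys = w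

length-take+drop : ∀ {A : Set} n (xs : List A) → length xs ≡ length (take n xs) + length (drop n xs)
length-take+drop n xs = trans (cong length (sym (take++drop≡id n xs))) (length-++ (take n xs))

2*#W-take+drop : ∀ n xs → 2 * #W xs ≡ 2 * #W (take n xs) + 2 * #W (drop n xs)
2*#W-take+drop n xs = begin
  2 * #W xs                               ≡⟨ cong (λ zs → 2 * #W zs) (sym (take++drop≡id n xs)) ⟩
  2 * #W (take n xs ++ drop n xs)         ≡⟨ cong (2 *_) (#W-++ (take n xs) (drop n xs)) ⟩
  2 * (#W (take n xs) + #W (drop n xs))   ≡⟨ *-distribˡ-+ 2 (#W (take n xs)) (#W (drop n xs)) ⟩
  2 * #W (take n xs) + 2 * #W (drop n xs) ∎
  where open ≡-Reasoning

within⇒length≤ : ∀ {k n xs} → Within k n xs → length xs ≤ n + 2 * #W xs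
within⇒length≤ {zero}  refl = z≤n
within⇒length≤ {suc k} {n} {xs} w = begin
  length xs                                        ≡⟨ length-take+drop n xs ⟩
  length (take n xs) + length (drop n xs)          ≤⟨ +-mono-≤ (length-take≤ n xs) (within⇒length≤ {k} w) ⟩
  n + (2 * #W (take n xs) + 2 * #W (drop n xs))    ≡⟨ cong (n +_) (2*#W-take+drop n xs) ⟨
  n + 2 * #W xs                                    ∎
  where open ≤-Reasoning

FullLength-passthrough : ∀ {k n xs} → Within (suc k) n xs → FullLength n xs →
                         length (take n xs) ≡ n × FullLength (2 * #W (take n xs)) (drop n xs)
FullLength-passthrough {k} {n} {xs} w full =
  ≤∧≤∧+≡+⇒≡ (length-take≤ n xs) (within⇒length≤ {k} w)
    (trans (sym (length-take+drop n xs)) (trans full (cong (n +_) (2*#W-take+drop n xs))))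

AtMostLevels : ℕ → FBT → Set
AtMostLevels k t = levels t ≤ k

roots : List FBT → List WL
roots []               = []
roots (leaf     ∷ ts) = L ∷ roots ts
roots (node _ _ ∷ ts) = W ∷ roots ts

children : List FBT → List FBT
children []               = []
children (leaf     ∷ ts) = children ts
children (node l r ∷ ts) = l ∷ r ∷ children ts

encode : ℕ → List FBT → List WL
encode zero    ts = []
encode (suc k) ts = roots ts ++ encode k (children ts)

-- The final clause only fires when F has too few trees.
graft : List WL → List FBT → List FBT
graft []       F           = []
graft (L ∷ ws) F           = leaf ∷ graft ws F
graft (W ∷ ws) (l ∷ r ∷ F) = node l r ∷ graft ws F
graft (W ∷ ws) _           = leaf ∷ graft ws []

decode : ℕ → ℕ → List WL → List FBT
decode zero    n xs = []
decode (suc k) n xs = graft (take n xs) (decode k (2 * #W (take n xs)) (drop n xs))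

length-roots : ∀ ts → length (roots ts) ≡ length ts
length-roots []               = refl
length-roots (leaf     ∷ ts) = cong suc (length-roots ts)
length-roots (node _ _ ∷ ts) = cong suc (length-roots ts)

length-children : ∀ ts → length (children ts) ≡ 2 * #W (roots ts)
length-children []               = refl
length-children (leaf     ∷ ts) = length-children ts
length-children (node _ _ ∷ ts) =
  trans (cong (λ c → suc (suc c)) (length-children ts)) (sym (*-suc 2 (#W (roots ts))))

length-graft : ∀ ws F → length (graft ws F) ≡ length ws
length-graft []       F           = refl
length-graft (L ∷ ws) F           = cong suc (length-graft ws F)
length-graft (W ∷ ws) (l ∷ r ∷ F) = cong suc (length-graft ws F)
length-graft (W ∷ ws) []          = cong suc (length-graft ws [])
length-graft (W ∷ ws) (_ ∷ [])    = cong suc (length-graft ws [])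

graft-roots-children : ∀ ts → graft (roots ts) (children ts) ≡ ts
graft-roots-children []               = refl
graft-roots-children (leaf     ∷ ts) = cong (leaf ∷_) (graft-roots-children ts)
graft-roots-children (node l r ∷ ts) = cong (node l r ∷_) (graft-roots-children ts)

roots-graft : ∀ ws F → length F ≡ 2 * #W ws → roots (graft ws F) ≡ ws
roots-graft []       F           _ = refl
roots-graft (L ∷ ws) F           e = cong (L ∷_) (roots-graft ws F e)
roots-graft (W ∷ ws) (l ∷ r ∷ F) e = cong (W ∷_) (roots-graft ws F (2+-injective (#W ws) e))
roots-graft (W ∷ ws) []          e = ⊥-elim (0≢2*suc (#W ws) e)
roots-graft (W ∷ ws) (_ ∷ [])    e = ⊥-elim (1≢2*suc (#W ws) e)

children-graft : ∀ ws F → length F ≡ 2 * #W ws → children (graft ws F) ≡ F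
children-graft []       []          _ = refl
children-graft (L ∷ ws) F           e = children-graft ws F e
children-graft (W ∷ ws) (l ∷ r ∷ F) e = cong (λ G → l ∷ r ∷ G) (children-graft ws F (2+-injective (#W ws) e))
children-graft (W ∷ ws) []          e = ⊥-elim (0≢2*suc (#W ws) e)
children-graft (W ∷ ws) (_ ∷ [])    e = ⊥-elim (1≢2*suc (#W ws) e)

no-tree-has-zero-levels : ∀ t → ¬ AtMostLevels 0 t
no-tree-has-zero-levels leaf       ()
no-tree-has-zero-levels (node _ _) ()

AtMostLevels-zero : ∀ {ts} → All (AtMostLevels 0) ts → ts ≡ []
AtMostLevels-zero []                = refl
AtMostLevels-zero {t ∷ _} (p ∷ _) = ⊥-elim (no-tree-has-zero-levels t p)

children-AtMostLevels : ∀ {k} ts → All (AtMostLevels (suc k)) ts → All (AtMostLevels k) (children ts)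
children-AtMostLevels []               []           = []
children-AtMostLevels (leaf     ∷ ts) (_ ∷ ps)     = children-AtMostLevels ts ps
children-AtMostLevels (node l r ∷ ts) (s≤s p ∷ ps) =
  m⊔n≤o⇒m≤o (levels l) (levels r) p ∷ m⊔n≤o⇒n≤o (levels l) (levels r) p ∷ children-AtMostLevels ts ps

graft-AtMostLevels : ∀ {k} ws {F} → All (AtMostLevels k) F → All (AtMostLevels (suc k)) (graft ws F)
graft-AtMostLevels []       ps             = []
graft-AtMostLevels (L ∷ ws) ps             = s≤s z≤n ∷ graft-AtMostLevels ws ps
graft-AtMostLevels (W ∷ ws) (pl ∷ pr ∷ ps) = s≤s (⊔-lub pl pr) ∷ graft-AtMostLevels ws ps
graft-AtMostLevels (W ∷ ws) []             = s≤s z≤n ∷ graft-AtMostLevels ws []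
graft-AtMostLevels (W ∷ ws) (_ ∷ [])       = s≤s z≤n ∷ graft-AtMostLevels ws []

decode-AtMostLevels : ∀ k n xs → All (AtMostLevels k) (decode k n xs)
decode-AtMostLevels zero    n xs = []
decode-AtMostLevels (suc k) n xs = graft-AtMostLevels (take n xs) (decode-AtMostLevels k _ (drop n xs))

decode-++ : ∀ k ws ys → decode (suc k) (length ws) (ws ++ ys) ≡ graft ws (decode k (2 * #W ws) ys)
decode-++ k ws ys rewrite take-length-++ ws ys | drop-length-++ ws ys = refl

encode-within : ∀ k ts → All (AtMostLevels k) ts → Within k (length ts) (encode k ts)
encode-within zero    ts ps = refl
encode-within (suc k) ts ps =
  subst (λ n → Within (suc k) n (encode (suc k) ts)) (length-roots ts)
    (within-++ {k} (roots ts)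
      (subst (λ n → Within k n (encode k (children ts))) (length-children ts)
        (encode-within k (children ts) (children-AtMostLevels ts ps))))

encode-LosingRecord : ∀ k ts → All (AtMostLevels k) ts → LosingRecord (length ts) (encode k ts)
encode-LosingRecord zero    ts ps rewrite AtMostLevels-zero ps = []
encode-LosingRecord (suc k) ts ps =
  subst (λ n → LosingRecord n (encode (suc k) ts)) (trans (+-identityʳ _) (length-roots ts))
    (LosingRecord-++ (roots ts)
      (subst (λ n → LosingRecord n (encode k (children ts)))
             (trans (length-children ts) (sym (+-identityʳ _)))
        (encode-LosingRecord k (children ts) (children-AtMostLevels ts ps))))

decode-encode : ∀ k ts → All (AtMostLevels k) ts → decode k (length ts) (encode k ts) ≡ ts
decode-encode zero    ts ps = sym (AtMostLevels-zero ps)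
decode-encode (suc k) ts ps = begin
  decode (suc k) (length ts) (roots ts ++ E)
    ≡⟨ cong (λ n → decode (suc k) n (roots ts ++ E)) (sym (length-roots ts)) ⟩
  decode (suc k) (length (roots ts)) (roots ts ++ E)
    ≡⟨ decode-++ k (roots ts) E ⟩
  graft (roots ts) (decode k (2 * #W (roots ts)) E)
    ≡⟨ cong (λ n → graft (roots ts) (decode k n E)) (sym (length-children ts)) ⟩
  graft (roots ts) (decode k (length (children ts)) E)
    ≡⟨ cong (graft (roots ts)) (decode-encode k (children ts) (children-AtMostLevels ts ps)) ⟩
  graft (roots ts) (children ts)
    ≡⟨ graft-roots-children ts ⟩
  ts ∎
  where
  open ≡-Reasoning
  E = encode k (children ts)

length-decode : ∀ k {n xs} → Within k n xs → FullLength n xs → length (decode k n xs) ≡ n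
length-decode zero    {n} refl full = sym (m+n≡0⇒m≡0 n (sym full))
length-decode (suc k) {n} {xs} w full =
  trans (length-graft (take n xs) _) (proj₁ (FullLength-passthrough {k} {n} {xs} w full))

encode-decode : ∀ k {n xs} → Within k n xs → FullLength n xs → encode k (decode k n xs) ≡ xs
encode-decode zero    refl _    = refl
encode-decode (suc k) {n} {xs} w full = begin
  roots (graft ws F) ++ encode k (children (graft ws F))
    ≡⟨ cong₂ (λ vs G → vs ++ encode k G) (roots-graft ws F |F|) (children-graft ws F |F|) ⟩
  ws ++ encode k F
    ≡⟨ cong (ws ++_) (encode-decode k w full-rest) ⟩
  ws ++ drop n xs
    ≡⟨ take++drop≡id n xs ⟩
  xs ∎
  where
  open ≡-Reasoning
  ws        = take n xs
  F         = decode k (2 * #W ws) (drop n xs)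
  full-rest = proj₂ (FullLength-passthrough {k} {n} {xs} w full)
  |F|       = length-decode k w full-rest

_≟WL_ : DecidableEquality WL
W ≟WL W = yes refl
W ≟WL L = no λ ()
L ≟WL W = no λ ()
L ≟WL L = yes refl

Within-irrelevant : ∀ k {n xs} → Irrelevant (Within k n xs)
Within-irrelevant zero    = Decidable⇒UIP.≡-irrelevant (≡-dec _≟WL_)
Within-irrelevant (suc k) = Within-irrelevant k

IsWinLoss-irrelevant : ∀ {xs} → Irrelevant (IsWinLoss xs)
IsWinLoss-irrelevant (p , e) (q , e′) = cong₂ _,_ (All.irrelevant <-irrelevant p q) (≡-irrelevant e e′)

Σ-≡-proj₁ : ∀ {A : Set} {P : A → Set} → (∀ {a} → Irrelevant (P a)) →
            {u v : Σ A P} → proj₁ u ≡ proj₁ v → u ≡ v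
Σ-≡-proj₁ irr {a , p} {.a , q} refl = cong (a ,_) (irr p q)

only : ∀ {A : Set} {P : A → Set} (xs : List A) → length xs ≡ 1 → All P xs → Σ A P
only (x ∷ []) _ (p ∷ []) = x , p

[only]≡ : ∀ {A : Set} {P : A → Set} xs (e : length xs ≡ 1) (ps : All P xs) →
          [ proj₁ (only xs e ps) ] ≡ xs
[only]≡ (x ∷ []) _ (p ∷ []) = refl

only-≡ : ∀ {A : Set} {P : A → Set} {xs} x {e : length xs ≡ 1} {ps : All P xs} →
         xs ≡ [ x ] → proj₁ (only xs e ps) ≡ x
only-≡ x {ps = _ ∷ []} refl = refl

module _ (k : ℕ) where

  treeToWord : TreesWithin k → WinLossWithin k
  treeToWord (t , p) =
    encode k [ t ]
    , LosingRecord⇒IsWinLoss (encode-LosingRecord k [ t ] (p ∷ []))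
    , encode-within k [ t ] (p ∷ [])

  wordToTree : WinLossWithin k → TreesWithin k
  wordToTree (xs , wl , w) =
    only (decode k 1 xs) (length-decode k w (IsWinLoss⇒FullLength wl)) (decode-AtMostLevels k 1 xs)

  wordToTree-treeToWord : ∀ t → wordToTree (treeToWord t) ≡ t
  wordToTree-treeToWord (t , p) = Σ-≡-proj₁ ≤-irrelevant (only-≡ t (decode-encode k [ t ] (p ∷ [])))

  treeToWord-wordToTree : ∀ x → treeToWord (wordToTree x) ≡ x
  treeToWord-wordToTree (xs , wl , w) =
    Σ-≡-proj₁ (λ (a , b) (c , d) → cong₂ _,_ (IsWinLoss-irrelevant a c) (Within-irrelevant k b d))
      (trans (cong (encode k) ([only]≡ (decode k 1 xs) _ _))
             (encode-decode k w (IsWinLoss⇒FullLength wl)))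

theorem4p4 : (k : ℕ) → 1 ≤ k → WinLossWithin k ⤖ TreesWithin k
theorem4p4 k _ =
  ↔⇒⤖ (mk↔ₛ′ (wordToTree k) (treeToWord k) (wordToTree-treeToWord k) (treeToWord-wordToTree k))
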